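{- Let $(\mathcal{R},\leq,r)$ be a closed triple satisfying the axioms \textbf{A1}, \textbf{A2}, \textbf{A3} and \textbf{A4}. Then the collection of Ramsey (equivalently, Kastanas Ramsey) subsets of $\mathcal{R}$ forms a $\sigma$-algebra.
   Context: $\mathcal{R}$ nonempty, $\le$ quasi-order on $\mathcal{R}$, $r:\mathcal{R}\times\omega\to\mathcal{AR}$, $r_n(A):=r(A,n)$, $\mathcal{AR}_n$ the image of $r_n$. A1: (1) $r_0(A)=\emptyset$; (2) $A\ne B\Rightarrow r_n(A)\ne r_n(B)$ for some $n$; (3) $r_n(A)=r_m(B)\Rightarrow n=m$ and $r_k(A)=r_k(B)$ for $k<n$. $\mathrm{lh}(a)$: the $n$ with $a\in\mathcal{AR}_n$; $a\sqsubseteq b$ iff $a=r_m(A)$, $b=r_n(A)$ for some $A$, $m\le n$. A2: a quasi-order $\leq_{\mathrm{fin}}$ on $\mathcal{AR}$ with (1) $\{a:a\leq_{\mathrm{fin}}b\}$ finite; (2) $A\le B$ iff $\forall n\exists m\ r_n(A)\leq_{\mathrm{fin}}r_m(B)$; (3) $a\sqsubseteq b\leq_{\mathrm{fin}}c\Rightarrow\exists d\sqsubseteq c\ a\leq_{\mathrm{fin}}d$. $[a,A]=\{B\le A:\exists n\ r_n(B)=a\}$; $[n,A]=[r_n(A),A]$; $\mathrm{depth}_B(a)=\min\{n:a\leq_{\mathrm{fin}}r_n(B)\}$ or $\infty$; $\mathcal{AR}{\upharpoonright}A=\{a:\exists n\ a\leq_{\mathrm{fin}}r_n(A)\}$; $r_n[a,A]=\{b\in\mathcal{AR}{\upharpoonright}A:a\sqsubseteq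 b,\mathrm{lh}(b)=n\}$. A3: (1) $\mathrm{depth}_B(a)<\infty\Rightarrow[a,A]\ne\emptyset$ for all $A\in[\mathrm{depth}_B(a),B]$; (2) $A\le B$, $[a,A]\ne\emptyset\Rightarrow\exists A'\in[\mathrm{depth}_B(a),B]$ with $\emptyset\ne[a,A']\subseteq[a,A]$. A4: if $\mathrm{depth}_B(a)<\infty$ and $\mathcal{O}\subseteq\mathcal{AR}_{\mathrm{lh}(a)+1}$ there is $A\in[\mathrm{depth}_B(a),B]$ with $r_{\mathrm{lh}(a)+1}[a,A]\subseteq\mathcal{O}$ or $\subseteq\mathcal{O}^c$. Closed triple: $\mathcal{R}$, identified with $\{(r_n(A))_n:A\in\mathcal{R}\}$, is closed in $\mathcal{AR}^{\mathbb N}$ (product of discrete spaces). Ramsey: for all $A$ and $a\in\mathcal{AR}{\upharpoonright}A$ there is $B\in[a,A]$ with $[a,B]\subseteq\mathcal{X}$ or $[a,B]\subseteq\mathcal{X}^c$. Kastanas game $K[a,A]$: with $a_0=a$, $B_{ -1}=A$, in round $n\ge0$ I plays $A_n\in[a_n,B_{n-1}]$, then II plays $a_{n+1}\in r_{\mathrm{lh}(a_n)+1}[a_n,A_n]$ and $B_n\in[a_{n+1},A_n]$; outcome: the $B$ with $r_{\mathrm{lh}(a)+n}(B)=a_n$ for all $n$. $\mathcal{X}$ is Kastanas Ramsey if for all $A$ and $a\in\mathcal{AR}{\upharpoonright}A$ there is $B\in[a,A]$ such that I has a strategy in $K[a,B]$ ensuring the outcome lies in $\mathcal{X}^c$, or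 II has a strategy in $K[a,B]$ ensuring the outcome lies in $\mathcal{X}$. -}

module Defs where

open import Data.Nat using (ℕ; zero; suc; _<_) renaming (_≤_ to _≤ℕ_)
open import Data.Product using (Σ; ∃; _×_; _,_)
open import Data.Sum using (_⊎_)
open import Data.Empty using (⊥)
open import Data.List using (List)
open import Data.List.Membership.Propositional using (_∈_)
open import Relation.Nullary using (¬_; Dec)
open import Relation.Binary.PropositionalEquality using (_≡_; _≢_)
open import Function.Bundles using (_⇔_)

-- The raw data of a triple (R, ≤, r) together with the relation ≤fin of A2.
-- AR is the set of finite approximations; emp is the approximation ∅ of A1(1).
record Triple : Set₁ where
  field
    R     : Set
    AR    : Set
    emp   : AR
    _≤_   : R → R → Set
    r     : R → ℕ → AR
    _≤fin_ : AR → AR → Set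

module Notions (T : Triple) where
  open Triple T

  -- a ∈ AR_n  (so lh(a) = n; unique by A1(3))
  HasLh : AR → ℕ → Set
  HasLh a n = ∃ λ A → r A n ≡ a

  _⊑_ : AR → AR → Set
  a ⊑ b = ∃ λ A → ∃ λ m → ∃ λ n → (m ≤ℕ n) × (r A m ≡ a) × (r A n ≡ b)

  [_,_] : AR → R → R → Set
  [ a , A ] B = (B ≤ A) × (∃ λ n → r B n ≡ a)

  [_,_]ₙ : ℕ → R → R → Set
  [ n , A ]ₙ = [ r A n , A ]

  InAR↾ : R → AR → Set
  InAR↾ A a = ∃ λ n → a ≤fin r A n

  IsDepth : R → AR → ℕ → Set
  IsDepth B a d = (a ≤fin r B d) × (∀ k → a ≤fin r B k → d ≤ℕ k)

  rSet : ℕ → AR → R → AR → Set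
  rSet n a A b = InAR↾ A b × (a ⊑ b) × HasLh b n

  NonEmpty : (R → Set) → Set
  NonEmpty S = ∃ λ B → S B

  _⊆_ : (R → Set) → (R → Set) → Set
  S ⊆ S' = ∀ B → S B → S' B

  record Axioms : Set₁ where
    field
      nonempty  : R
      ≤-refl    : ∀ A → A ≤ A
      ≤-trans   : ∀ A B C → A ≤ B → B ≤ C → A ≤ C
      A1-1 : ∀ A → r A 0 ≡ emp
      A1-2 : ∀ A B → A ≢ B → ∃ λ n → r A n ≢ r B n
      A1-3 : ∀ A B n m → r A n ≡ r B m → (n ≡ m) × (∀ k → k < n → r A k ≡ r B k)
      ≤fin-refl  : ∀ a → a ≤fin a
      ≤fin-trans : ∀ a b c → a ≤fin b → b ≤fin c → a ≤fin c
      A2-1 : ∀ b → Σ (List AR) λ l → ∀ a → a ≤fin b → a ∈ l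
      A2-2 : ∀ A B → (A ≤ B) ⇔ (∀ n → ∃ λ m → r A n ≤fin r B m)
      A2-3 : ∀ a b c → a ⊑ b → b ≤fin c → ∃ λ d → (d ⊑ c) × (a ≤fin d)
      A3-1 : ∀ B a d → IsDepth B a d → ∀ A → [ d , B ]ₙ A → NonEmpty [ a , A ]
      A3-2 : ∀ A B a → A ≤ B → NonEmpty [ a , A ] → ∀ d → IsDepth B a d →
             ∃ λ A' → [ d , B ]ₙ A' × NonEmpty [ a , A' ] × ([ a , A' ] ⊆ [ a , A ])
      -- A4 (O ⊆ AR_{lh(a)+1} is represented by an arbitrary predicate on AR;
      --     only its trace on AR_{lh(a)+1} matters)
      A4 : ∀ B a d → IsDepth B a d → ∀ n → HasLh a n → (O : AR → Set) →
           ∃ λ A → [ d , B ]ₙ A ×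
             ((∀ b → rSet (suc n) a A b → O b) ⊎ (∀ b → rSet (suc n) a A b → ¬ O b))

  -- R, as a set of sequences (r_n(A))_n, is closed in AR^ℕ
  Closed : Set
  Closed = ∀ (f : ℕ → AR) → (∀ k → ∃ λ A → ∀ i → i < k → r A i ≡ f i) →
           ∃ λ A → ∀ i → r A i ≡ f i

  Ramsey : (R → Set) → Set
  Ramsey X = ∀ A a → InAR↾ A a →
    ∃ λ B → [ a , A ] B × (([ a , B ] ⊆ X) ⊎ ([ a , B ] ⊆ (λ C → ¬ X C)))

  record IsSigmaAlgebra (Coll : (R → Set) → Set) : Set₁ where
    field
      has-empty : Coll (λ _ → ⊥)
      has-compl : ∀ X → Coll X → Coll (λ A → ¬ X A)
      has-union : ∀ (Xs : ℕ → R → Set) → (∀ n → Coll (Xs n)) →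
                  Coll (λ A → ∃ λ n → Xs n A)

-- Classical logic (the paper works in ZFC)
ExcludedMiddle : Set₁
ExcludedMiddle = (P : Set) → Dec P

{-# OPTIONS --safe #-}
module Submission where

-- Complements are immediate, and ∅ is Ramsey by A3(1).  For X = ⋃ Xₙ and a ∈ AR↾A, fusion
-- arguments (A2(1), A3 and closedness of R) give B ∈ [a, A] such that [b, B] is homogeneous
-- for every Xₙ with n ≤ lh(b), and B accepts ([b, B] ⊆ X) or rejects (no C ∈ [b, B] accepts b)
-- every b ⊒ a.  If a is rejected, A4 lets one more fusion pass rejection from each b to all of
-- its one-step extensions, so every initial segment ⊒ a of every E ∈ [a, B] is rejected.  But
-- if E ∈ Xₙ, homogeneity makes E accept its own initial segment of length n + lh(a), so
-- [a, B] misses X.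

open import Defs
open import Data.Nat using (ℕ; zero; suc; _+_; _⊔_; _<_; _≤′_; ≤′-refl; ≤′-step; s≤s; z≤n)
  renaming (_≤_ to _≤ℕ_)
open import Data.Nat.Induction using (<-rec)
import Data.Nat.Properties as ℕ
open import Data.Product using (∃; _×_; _,_; proj₁; proj₂; map₂)
open import Data.Sum using (_⊎_; inj₁; inj₂)
open import Data.Empty using (⊥; ⊥-elim)
open import Data.List using (List; []; _∷_; upTo)
open import Data.List.Relation.Unary.Any using (here; there)
open import Data.List.Membership.Propositional using (_∈_)
open import Data.List.Membership.Propositional.Properties using (∈-upTo⁺)
open import Relation.Nullary using (¬_; yes; no)
open import Relation.Binary.PropositionalEquality using (_≡_; refl; sym; trans; subst)
open import Function using (const)
open import Function.Bundles using (Equivalence)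

least-witness : ExcludedMiddle → (Q : ℕ → Set) → ∀ {n} → Q n →
                ∃ λ k → Q k × (∀ j → Q j → k ≤ℕ j)
least-witness em Q {n} = <-rec Least search n
  where
  Least : ℕ → Set
  Least n = Q n → ∃ λ k → Q k × (∀ j → Q j → k ≤ℕ j)

  search : ∀ n → (∀ {m} → m < n → Least m) → Least n
  search n smaller qn with em (∃ λ j → j < n × Q j)
  ... | yes (j , j<n , qj) = smaller j<n qj
  ... | no none = n , qn , λ j qj → ℕ.≮⇒≥ (λ j<n → none (j , j<n , qj))

module _ (T : Triple) where
  open Triple T
  open Notions T

  Homogeneous : (R → Set) → (R → Set) → Set
  Homogeneous X S = (S ⊆ X) ⊎ (S ⊆ (λ C → ¬ X C))

  Homogeneous-⊆ : ∀ {X S S'} → S' ⊆ S → Homogeneous X S → Homogeneous X S'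
  Homogeneous-⊆ S'⊆S (inj₁ S⊆X) = inj₁ λ C C∈S' → S⊆X C (S'⊆S C C∈S')
  Homogeneous-⊆ S'⊆S (inj₂ S⊆∁X) = inj₂ λ C C∈S' → S⊆∁X C (S'⊆S C C∈S')

  Homogeneous-∁ : ∀ {X S} → Homogeneous X S → Homogeneous (λ C → ¬ X C) S
  Homogeneous-∁ (inj₁ S⊆X) = inj₂ λ C C∈S ¬x → ¬x (S⊆X C C∈S)
  Homogeneous-∁ (inj₂ S⊆∁X) = inj₁ S⊆∁X

  Ramsey-∁ : ∀ X → Ramsey X → Ramsey (λ C → ¬ X C)
  Ramsey-∁ X ramsey A a a∈A = map₂ (map₂ Homogeneous-∁) (ramsey A a a∈A)

  ⋃ : (ℕ → R → Set) → R → Set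
  ⋃ Xs C = ∃ λ n → Xs n C

  Antitone : (R → Set) → Set
  Antitone Q = ∀ {C C'} → C' ≤ C → Q C → Q C'

  Accepts : (R → Set) → AR → R → Set
  Accepts X b C = [ b , C ] ⊆ X

  Rejects : (R → Set) → AR → R → Set
  Rejects X b C = ∀ A → [ b , C ] A → ¬ Accepts X b A

  Decides : (R → Set) → AR → R → Set
  Decides X b C = Accepts X b C ⊎ Rejects X b C

  Successor : R → AR → AR → Set
  Successor C b c = ∃ λ m → HasLh b m × rSet (suc m) b C c

  HomogeneousUpToLh : (ℕ → R → Set) → AR → R → Set
  HomogeneousUpToLh Xs b C = ∀ m → HasLh b m → ∀ n → n ≤ℕ m → Homogeneous (Xs n) [ b , C ]

  DenseBelow : ℕ → R → (R → Set) → Set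
  DenseBelow k C₀ Q = ∀ C → [ k , C₀ ]ₙ C → ∃ λ C' → [ k , C ]ₙ C' × Q C'

  AcceptsNoSegment : (R → Set) → AR → R → Set
  AcceptsNoSegment X a B = ∀ E j → E ≤ B → r E j ≡ a → ∀ i → j ≤ℕ i → ¬ Accepts X (r E i) E

  RejectionPropagates : (R → Set) → R → AR → R → Set
  RejectionPropagates X B₁ b C = Rejects X b B₁ → ∀ c → Successor C b c → Rejects X c B₁

  module _ (ax : Axioms) where
    open Axioms ax hiding (≤-trans)

    ≤-trans : ∀ {A B C} → A ≤ B → B ≤ C → A ≤ C
    ≤-trans = Axioms.≤-trans ax _ _ _

    ≤⇒≤fin : ∀ {A B} → A ≤ B → ∀ n → ∃ λ m → r A n ≤fin r B m
    ≤⇒≤fin {A} {B} = Equivalence.to (A2-2 A B)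

    ≤fin⇒≤ : ∀ {A B} → (∀ n → ∃ λ m → r A n ≤fin r B m) → A ≤ B
    ≤fin⇒≤ {A} {B} = Equivalence.from (A2-2 A B)

    r-prefix : ∀ {A B m n n'} → r A n ≡ r B n' → m ≤ℕ n → r A m ≡ r B m
    r-prefix {A} {B} {m} {n} {n'} eq m≤n with A1-3 A B n n' eq | ℕ.m≤n⇒m<n∨m≡n m≤n
    ... | _ , agree | inj₁ m<n = agree m m<n
    ... | refl , _ | inj₂ refl = eq

    lh-unique : ∀ {b m n} → HasLh b m → HasLh b n → m ≡ n
    lh-unique (A , eqA) (B , eqB) = proj₁ (A1-3 A B _ _ (trans eqA (sym eqB)))

    ⊑⇒HasLh : ∀ {a b} → a ⊑ b → ∃ λ m → HasLh b m
    ⊑⇒HasLh (A , _ , m , _ , _ , eq) = m , A , eq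

    r-⊑ : ∀ E {i j} → i ≤ℕ j → r E i ⊑ r E j
    r-⊑ E {i} {j} i≤j = E , i , j , i≤j , refl , refl

    ⊑-trans : ∀ {a b c} → a ⊑ b → b ⊑ c → a ⊑ c
    ⊑-trans (A , i , j , i≤j , eqa , eqb) (A' , j' , l , j'≤l , eqb' , eqc)
      with A1-3 A A' j j' (trans eqb (sym eqb'))
    ... | refl , _ =
      A' , i , l , ℕ.≤-trans i≤j j'≤l , trans (sym (r-prefix (trans eqb (sym eqb')) i≤j)) eqa , eqc

    r-InAR↾ : ∀ {C} n → InAR↾ C (r C n)
    r-InAR↾ {C} n = n , ≤fin-refl (r C n)

    InAR↾-mono : ∀ {C D b} → C ≤ D → InAR↾ C b → InAR↾ D b
    InAR↾-mono C≤D (n , below) with ≤⇒≤fin C≤D n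
    ... | m , step = m , ≤fin-trans _ _ _ below step

    [,]-antitone : ∀ {b C C'} → C' ≤ C → [ b , C' ] ⊆ [ b , C ]
    [,]-antitone C'≤C E (E≤C' , n , eq) = ≤-trans E≤C' C'≤C , n , eq

    [,]ₙ-refl : ∀ {k C} → [ k , C ]ₙ C
    [,]ₙ-refl {k} {C} = ≤-refl C , k , refl

    [,]ₙ-agree : ∀ {k C C'} → [ k , C ]ₙ C' → r C' k ≡ r C k
    [,]ₙ-agree {k} {C} {C'} (_ , n , eq) with A1-3 C' C n k eq
    ... | refl , _ = eq

    [,]ₙ-trans : ∀ {k C C' C''} → [ k , C ]ₙ C' → [ k , C' ]ₙ C'' → [ k , C ]ₙ C''
    [,]ₙ-trans C'∈ C''∈ = ≤-trans (proj₁ C''∈) (proj₁ C'∈) , _ , trans ([,]ₙ-agree C''∈) ([,]ₙ-agree C'∈)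

    IsDepth-agree : ∀ {C C' b k} → r C' k ≡ r C k → IsDepth C b k → IsDepth C' b k
    IsDepth-agree {C' = C'} {b} {k} eq (below , least) = subst (b ≤fin_) (sym eq) below , least'
      where
      least' : ∀ j → b ≤fin r C' j → k ≤ℕ j
      least' j below' with k ℕ.≤? j
      ... | yes k≤j = k≤j
      ... | no k≰j = least j (subst (b ≤fin_) (r-prefix eq (ℕ.<⇒≤ (ℕ.≰⇒> k≰j))) below')

    IsDepth-≤ : ∀ {B a c d e} → IsDepth B a d → a ⊑ c → c ≤fin r B e → d ≤ℕ e
    IsDepth-≤ {B} {a} {c} {e = e} (_ , least) a⊑c c≤ with A2-3 a c (r B e) a⊑c c≤
    ... | _ , (A , m , n , m≤n , refl , eqB) , a≤ with A1-3 A B n e eqB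
    ... | refl , _ = ℕ.≤-trans (least m (subst (a ≤fin_) (r-prefix eqB m≤n) a≤)) m≤n

    refine-to-depth : ∀ {A C b k} → IsDepth C b k → [ b , C ] A →
                      ∃ λ C' → [ k , C ]ₙ C' × [ b , C' ] ⊆ [ b , A ]
    refine-to-depth {A} {C} {b} {k} depth (A≤C , n , eq) with A3-2 A C b A≤C (A , ≤-refl A , n , eq) k depth
    ... | C' , C'∈ , _ , sub = C' , C'∈ , sub

    dense-all : ∀ {I : Set} {k C₀} (Q : I → R → Set) → (∀ i → Antitone (Q i)) →
                (∀ i → DenseBelow k C₀ (Q i)) → (is : List I) → DenseBelow k C₀ (λ C → ∀ i → i ∈ is → Q i C)
    dense-all Q Q-antitone Q-dense [] C C∈ = C , [,]ₙ-refl , λ _ ()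
    dense-all Q Q-antitone Q-dense (i ∷ is) C C∈
      with Q-dense i C C∈
    ... | C₁ , C₁∈ , q₁ with dense-all Q Q-antitone Q-dense is C₁ ([,]ₙ-trans C∈ C₁∈)
    ... | C₂ , C₂∈ , q₂ = C₂ , [,]ₙ-trans C₁∈ C₂∈ , λ
      { j (here refl) → Q-antitone i (proj₁ C₂∈) q₁
      ; j (there j∈is) → q₂ j j∈is
      }

    Homogeneous-dense : ∀ {Y C b k} → Ramsey Y → IsDepth C b k →
                        ∃ λ C' → [ k , C ]ₙ C' × Homogeneous Y [ b , C' ]
    Homogeneous-dense {C = C} {b} {k} ramsey depth with ramsey C b (k , proj₁ depth)
    ... | A , A∈ , homogeneous with refine-to-depth depth A∈
    ... | C' , C'∈ , sub = C' , C'∈ , Homogeneous-⊆ sub homogeneous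

    HomogeneousUpToLh-antitone : ∀ Xs {b} → Antitone (HomogeneousUpToLh Xs b)
    HomogeneousUpToLh-antitone Xs C'≤C homogeneous m lh n n≤m =
      Homogeneous-⊆ ([,]-antitone C'≤C) (homogeneous m lh n n≤m)

    HomogeneousUpToLh-dense : ∀ Xs → (∀ n → Ramsey (Xs n)) → ∀ {b C k m} → HasLh b m → IsDepth C b k →
                              ∃ λ C' → [ k , C ]ₙ C' × HomogeneousUpToLh Xs b C'
    HomogeneousUpToLh-dense Xs ramsey {b} {C} {k} {m} lh depth
      with dense-all (λ n C' → Homogeneous (Xs n) [ b , C' ]) (λ n C'≤C → Homogeneous-⊆ ([,]-antitone C'≤C))
             (λ n C₁ C₁∈ → Homogeneous-dense (ramsey n) (IsDepth-agree ([,]ₙ-agree C₁∈) depth))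
             (upTo (suc m)) C [,]ₙ-refl
    ... | C' , C'∈ , homogeneous = C' , C'∈ , λ m' lh' n n≤m' →
      homogeneous n (∈-upTo⁺ (s≤s (subst (n ≤ℕ_) (lh-unique lh' lh) n≤m')))

    Homogeneous⇒Accepts : ∀ {Y b C E} → [ b , C ] E → Y E → Homogeneous Y [ b , C ] → Accepts Y b E
    Homogeneous⇒Accepts (E≤C , _) _ (inj₁ ⊆Y) F F∈ = ⊆Y F ([,]-antitone E≤C F F∈)
    Homogeneous⇒Accepts E∈ y (inj₂ ⊆∁Y) = ⊥-elim (⊆∁Y _ E∈ y)

    Accepts-antitone : ∀ X {b} → Antitone (Accepts X b)
    Accepts-antitone X C'≤C accepts E E∈ = accepts E ([,]-antitone C'≤C E E∈)

    Rejects-antitone : ∀ X {b} → Antitone (Rejects X b)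
    Rejects-antitone X C'≤C rejects A A∈ = rejects A ([,]-antitone C'≤C A A∈)

    Decides-antitone : ∀ X {b} → Antitone (Decides X b)
    Decides-antitone X C'≤C (inj₁ accepts) = inj₁ (Accepts-antitone X C'≤C accepts)
    Decides-antitone X C'≤C (inj₂ rejects) = inj₂ (Rejects-antitone X C'≤C rejects)

    r-Successor : ∀ {C E} i → E ≤ C → Successor C (r E i) (r E (suc i))
    r-Successor {E = E} i E≤C =
      i , (E , refl) , InAR↾-mono E≤C (r-InAR↾ (suc i)) , r-⊑ E (ℕ.n≤1+n i) , (E , refl)

    Successor-antitone : ∀ {C C' b c} → C' ≤ C → Successor C' b c → Successor C b c
    Successor-antitone C'≤C (m , lh , c∈ , b⊑c , lh') = m , lh , InAR↾-mono C'≤C c∈ , b⊑c , lh'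

    Successor⇒rSet : ∀ {C b c m} → HasLh b m → Successor C b c → rSet (suc m) b C c
    Successor⇒rSet lh (m' , lh' , in-rSet) = subst (λ n → rSet (suc n) _ _ _) (lh-unique lh' lh) in-rSet

    Accepts-by-successors : ∀ X {B C b} → C ≤ B → (∀ c → Successor C b c → Accepts X c B) → Accepts X b C
    Accepts-by-successors X C≤B accepted E (E≤C , i , refl) =
      accepted (r E (suc i)) (r-Successor i E≤C) E (≤-trans E≤C C≤B , suc i , refl)

    successors-accepted⇒¬Rejects : ∀ X {B C b k} → C ≤ B → IsDepth C b k →
                                   (∀ c → Successor C b c → Accepts X c B) → ¬ Rejects X b B
    successors-accepted⇒¬Rejects X {C = C} {b} {k} C≤B depth accepted rejects
      with A3-1 C b k depth C [,]ₙ-refl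
    ... | D , D≤C , n , eq = rejects D (≤-trans D≤C C≤B , n , eq)
      (Accepts-by-successors X (≤-trans D≤C C≤B) λ c succ → accepted c (Successor-antitone D≤C succ))

    -- A4 applied to the set of rejected one-step extensions: in the alternative where none is
    -- rejected, some D ∈ [b, B] would accept b.
    rejection-propagates : ∀ X {B C b k m} → C ≤ B → IsDepth C b k → HasLh b m → Rejects X b B →
                           (∀ c → Successor C b c → Decides X c B) →
                           ∃ λ C' → [ k , C ]ₙ C' × (∀ c → Successor C' b c → Rejects X c B)
    rejection-propagates X {B} {C} {b} {k} {m} C≤B depth lh rejects decided
      with A4 C b k depth m lh (λ c → Rejects X c B)
    ... | C' , C'∈ , inj₁ all-rejected = C' , C'∈ , λ c succ → all-rejected c (Successor⇒rSet lh succ)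
    ... | C' , C'∈ , inj₂ none-rejected = ⊥-elim
      (successors-accepted⇒¬Rejects X (≤-trans (proj₁ C'∈) C≤B) (IsDepth-agree ([,]ₙ-agree C'∈) depth)
        accepted rejects)
      where
      accepted : ∀ c → Successor C' b c → Accepts X c B
      accepted c succ with decided c (Successor-antitone (proj₁ C'∈) succ)
      ... | inj₁ accepts = accepts
      ... | inj₂ rejects-c = ⊥-elim (none-rejected c (Successor⇒rSet lh succ) rejects-c)

    RejectionPropagates-antitone : ∀ X {B₁ b} → Antitone (RejectionPropagates X B₁ b)
    RejectionPropagates-antitone X C'≤C propagates rejects c succ =
      propagates rejects c (Successor-antitone C'≤C succ)

    rejects-along : ∀ X {B B₁ a E j} → (∀ b → a ⊑ b → InAR↾ B b → RejectionPropagates X B₁ b B) →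
                    E ≤ B → r E j ≡ a → Rejects X a B₁ → ∀ {i} → j ≤′ i → Rejects X (r E i) B₁
    rejects-along X propagates E≤B refl rejects ≤′-refl = rejects
    rejects-along X {E = E} propagates E≤B refl rejects (≤′-step {i} j≤′i) =
      propagates (r E i) (r-⊑ E (ℕ.≤′⇒≤ j≤′i)) (InAR↾-mono E≤B (r-InAR↾ i))
        (rejects-along X propagates E≤B refl rejects j≤′i) (r E (suc i)) (r-Successor i E≤B)

    -- Homogeneity of B₀ makes each E ∈ Xₙ accept its own initial segment of length n + lh(a).
    ⋃-avoided : ∀ Xs {a B₀ B} → (∀ b → a ⊑ b → InAR↾ B₀ b → HomogeneousUpToLh Xs b B₀) → B ≤ B₀ →
                AcceptsNoSegment (⋃ Xs) a B → [ a , B ] ⊆ (λ E → ¬ ⋃ Xs E)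
    ⋃-avoided Xs homogeneous B≤B₀ never-accepts E (E≤B , j , refl) (n , x) =
      never-accepts E j E≤B refl (n + j) (ℕ.m≤n+m j n)
        λ F F∈ → n , Homogeneous⇒Accepts (E≤B₀ , n + j , refl) x segment-homogeneous F F∈
      where
      E≤B₀ : E ≤ _
      E≤B₀ = ≤-trans E≤B B≤B₀

      segment-homogeneous : Homogeneous (Xs n) [ r E (n + j) , _ ]
      segment-homogeneous =
        homogeneous (r E (n + j)) (r-⊑ E (ℕ.m≤n+m j n)) (InAR↾-mono E≤B₀ (r-InAR↾ (n + j)))
          (n + j) (E , refl) n (ℕ.m≤m+n n j)

    module _ (em : ExcludedMiddle) where

      depth-exists : ∀ {C b} → InAR↾ C b → ∃ λ k → IsDepth C b k
      depth-exists {C} {b} (_ , below) = least-witness em (λ j → b ≤fin r C j) below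

      Ramsey-∅ : Ramsey (λ _ → ⊥)
      Ramsey-∅ A a a∈A with depth-exists a∈A
      ... | d , depth with A3-1 A a d depth A [,]ₙ-refl
      ... | B , B∈ = B , B∈ , inj₂ λ _ _ ()

      Decides-dense : ∀ X {C b k} → IsDepth C b k → ∃ λ C' → [ k , C ]ₙ C' × Decides X b C'
      Decides-dense X {C} {b} depth with em (Rejects X b C)
      ... | yes rejects = C , [,]ₙ-refl , inj₂ rejects
      ... | no ¬rejects with em (∃ λ A → [ b , C ] A × Accepts X b A)
      ...   | no ¬accepted = ⊥-elim (¬rejects λ A A∈ accepts → ¬accepted (A , A∈ , accepts))
      ...   | yes (A , A∈ , accepts) with refine-to-depth depth A∈
      ...     | C' , C'∈ , sub = C' , C'∈ , inj₁ λ E E∈ → accepts E (sub E E∈)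

      RejectionPropagates-dense : ∀ X {B₁ a C b k} → (∀ b → a ⊑ b → InAR↾ B₁ b → Decides X b B₁) →
                                  C ≤ B₁ → a ⊑ b → IsDepth C b k →
                                  ∃ λ C' → [ k , C ]ₙ C' × RejectionPropagates X B₁ b C'
      RejectionPropagates-dense X {B₁} {C = C} {b} decided C≤B₁ a⊑b depth with em (Rejects X b B₁)
      ... | no ¬rejects = C , [,]ₙ-refl , λ rejects → ⊥-elim (¬rejects rejects)
      ... | yes rejects = map₂ (map₂ const) (rejection-propagates X C≤B₁ depth (proj₂ (⊑⇒HasLh a⊑b)) rejects
        λ { c (_ , _ , c∈ , b⊑c , _) → decided c (⊑-trans a⊑b b⊑c) (InAR↾-mono C≤B₁ c∈) })

      module _ (closed : Closed) where

        module Fusion (P : AR → R → Set) (P-antitone : ∀ {b} → Antitone (P b)) {A₀ : R} {a : AR} {d : ℕ}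
                      (dense : ∀ {k b C} → C ≤ A₀ → a ⊑ b → IsDepth C b k → ∃ λ C' → [ k , C ]ₙ C' × P b C')
                      where

          Thinned : ℕ → R → AR → R → Set
          Thinned k C b C' = a ⊑ b → IsDepth C b k → P b C'

          Thinned-dense : ∀ {k C} → C ≤ A₀ → ∀ b → DenseBelow k C (Thinned k C b)
          Thinned-dense {k} {C} C≤A₀ b C₁ C₁∈ with em (a ⊑ b × IsDepth C b k)
          ... | no ¬relevant = C₁ , [,]ₙ-refl , λ a⊑b depth → ⊥-elim (¬relevant (a⊑b , depth))
          ... | yes (a⊑b , depth) =
            map₂ (map₂ λ p _ _ → p)
              (dense (≤-trans (proj₁ C₁∈) C≤A₀) a⊑b (IsDepth-agree ([,]ₙ-agree C₁∈) depth))

          -- A2(1): only the finitely many b ≤fin r_k(C) can have depth k in C.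
          thin : ∀ k C → C ≤ A₀ → ∃ λ C' → [ k , C ]ₙ C' × (∀ b → a ⊑ b → IsDepth C b k → P b C')
          thin k C C≤A₀ with A2-1 (r C k)
          ... | bs , complete
            with dense-all (Thinned k C) (λ b C'≤C thinned a⊑b depth → P-antitone C'≤C (thinned a⊑b depth))
                   (Thinned-dense C≤A₀) bs C [,]ₙ-refl
          ... | C' , C'∈ , thinned = C' , C'∈ , λ b a⊑b depth → thinned b (complete b (proj₁ depth)) a⊑b depth

          -- Stage k thins at level k ⊔ d, so r_d never changes and the limit stays in [d, A₀].
          stage : ℕ → ∃ λ C → C ≤ A₀
          stage zero = A₀ , ≤-refl A₀
          stage (suc k) =
            let C , C≤A₀ = stage k
                C' , C'∈ , _ = thin (k ⊔ d) C C≤A₀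
            in C' , ≤-trans (proj₁ C'∈) C≤A₀

          S : ℕ → R
          S k = proj₁ (stage k)

          S-step : ∀ k → [ k ⊔ d , S k ]ₙ (S (suc k))
          S-step k = proj₁ (proj₂ (thin (k ⊔ d) (S k) (proj₂ (stage k))))

          S-thinned : ∀ k b → a ⊑ b → IsDepth (S k) b (k ⊔ d) → P b (S (suc k))
          S-thinned k = proj₂ (proj₂ (thin (k ⊔ d) (S k) (proj₂ (stage k))))

          S-decreasing : ∀ {j k} → j ≤′ k → S k ≤ S j
          S-decreasing ≤′-refl = ≤-refl _
          S-decreasing (≤′-step {k} j≤′k) = ≤-trans (proj₁ (S-step k)) (S-decreasing j≤′k)

          S-stable : ∀ {i j k} → j ≤′ k → i ≤ℕ j ⊔ d → r (S k) i ≡ r (S j) i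
          S-stable ≤′-refl _ = refl
          S-stable (≤′-step {k} j≤′k) i≤ =
            trans (r-prefix ([,]ₙ-agree (S-step k)) (ℕ.≤-trans i≤ (ℕ.⊔-monoˡ-≤ d (ℕ.≤′⇒≤ j≤′k))))
                  (S-stable j≤′k i≤)

          diagonal : ∃ λ B → ∀ i → r B i ≡ r (S i) i
          diagonal = closed (λ i → r (S i) i)
            λ k → S k , λ i i<k → S-stable (ℕ.≤⇒≤′ (ℕ.<⇒≤ i<k)) (ℕ.m≤m⊔n i d)

          B : R
          B = proj₁ diagonal

          B-diagonal : ∀ i → r B i ≡ r (S i) i
          B-diagonal = proj₂ diagonal

          B≤S : ∀ j → B ≤ S j
          B≤S j = ≤fin⇒≤ λ n → map₂ (subst (_≤fin r (S j) _) (r≡ n)) (≤⇒≤fin (S-decreasing (ℕ.m≤′m+n j n)) n)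
            where
            r≡ : ∀ n → r (S (j + n)) n ≡ r B n
            r≡ n = trans (S-stable (ℕ.≤⇒≤′ (ℕ.m≤n+m n j)) (ℕ.m≤m⊔n n d)) (sym (B-diagonal n))

          B∈[d,A₀] : [ d , A₀ ]ₙ B
          B∈[d,A₀] = B≤S 0 , d , trans (B-diagonal d) (S-stable {k = d} (ℕ.≤⇒≤′ z≤n) ℕ.≤-refl)

          B-thinned : ∀ {k b} → d ≤ℕ k → a ⊑ b → IsDepth B b k → P b B
          B-thinned {k} {b} d≤k a⊑b depth = P-antitone (B≤S (suc k)) (S-thinned k b a⊑b
            (subst (IsDepth (S k) b) (sym (ℕ.m≥n⇒m⊔n≡m d≤k)) (IsDepth-agree (sym (B-diagonal k)) depth)))

          -- Kept abstract so that unification in its clients never unfolds the construction.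
          abstract
            fusion : IsDepth A₀ a d → ∃ λ B → [ d , A₀ ]ₙ B × (∀ b → a ⊑ b → InAR↾ B b → P b B)
            fusion a-depth = B , B∈[d,A₀] , λ b a⊑b b∈B →
              let k , b-depth = depth-exists b∈B
                  d≤k = IsDepth-≤ (IsDepth-agree ([,]ₙ-agree B∈[d,A₀]) a-depth) a⊑b (proj₁ b-depth)
              in B-thinned d≤k a⊑b b-depth

        rejection-everywhere : ∀ X {B₁ a d} → IsDepth B₁ a d → (∀ b → a ⊑ b → InAR↾ B₁ b → Decides X b B₁) →
                               Rejects X a B₁ →
                               ∃ λ D → [ a , B₁ ] D ×
                                 (∀ E j → E ≤ D → r E j ≡ a → ∀ i → j ≤ℕ i → Rejects X (r E i) B₁)
        rejection-everywhere X {B₁} {a} {d} a-depth decided rejects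
          with Fusion.fusion (RejectionPropagates X B₁) (RejectionPropagates-antitone X)
                 (RejectionPropagates-dense X decided) a-depth
        ... | B₂ , B₂∈ , propagates with A3-1 B₂ a d (IsDepth-agree ([,]ₙ-agree B₂∈) a-depth) B₂ [,]ₙ-refl
        ... | D , D≤B₂ , n , eq = D , (≤-trans D≤B₂ (proj₁ B₂∈) , n , eq) , λ E j E≤D eqE i j≤i →
          rejects-along X propagates (≤-trans E≤D D≤B₂) eqE rejects (ℕ.≤⇒≤′ j≤i)

        accept-or-reject : ∀ X {A a d} → IsDepth A a d →
                           ∃ λ B → [ a , A ] B × (Accepts X a B ⊎ AcceptsNoSegment X a B)
        accept-or-reject X {a = a} {d} a-depth
          with Fusion.fusion (Decides X) (Decides-antitone X) (λ _ _ → Decides-dense X) a-depth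
        ... | B₁ , B₁∈ , decided with IsDepth-agree ([,]ₙ-agree B₁∈) a-depth
        ... | a-depth₁ with A3-1 B₁ a d a-depth₁ B₁ [,]ₙ-refl
        ... | D , D∈@(D≤B₁ , n , eq) with decided a (D , n , n , ℕ.≤-refl , eq , eq) (d , proj₁ a-depth₁)
        ... | inj₁ accepts = D , [,]-antitone (proj₁ B₁∈) D D∈ , inj₁ (Accepts-antitone X D≤B₁ accepts)
        ... | inj₂ rejects with rejection-everywhere X a-depth₁ decided rejects
        ... | D′ , D′∈ , rejected = D′ , [,]-antitone (proj₁ B₁∈) D′ D′∈ , inj₂ λ E j E≤D′ eqE i j≤i →
          rejected E j E≤D′ eqE i j≤i E (≤-trans E≤D′ (proj₁ D′∈) , i , refl)

        Ramsey-⋃ : ∀ Xs → (∀ n → Ramsey (Xs n)) → Ramsey (⋃ Xs)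
        Ramsey-⋃ Xs ramsey A a a∈A with depth-exists a∈A
        ... | d , a-depth
          with Fusion.fusion (HomogeneousUpToLh Xs) (HomogeneousUpToLh-antitone Xs)
                 (λ _ a⊑b → HomogeneousUpToLh-dense Xs ramsey (proj₂ (⊑⇒HasLh a⊑b))) a-depth
        ... | B₀ , B₀∈ , homogeneous with accept-or-reject (⋃ Xs) (IsDepth-agree ([,]ₙ-agree B₀∈) a-depth)
        ... | B , B∈ , inj₁ accepts = B , [,]-antitone (proj₁ B₀∈) B B∈ , inj₁ accepts
        ... | B , B∈ , inj₂ never-accepts =
          B , [,]-antitone (proj₁ B₀∈) B B∈ , inj₂ (⋃-avoided Xs homogeneous (proj₁ B∈) never-accepts)

corollary3p18 : ExcludedMiddle → (T : Triple) → Notions.Axioms T → Notions.Closed T →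
                Notions.IsSigmaAlgebra T (Notions.Ramsey T)
corollary3p18 em T ax closed = record
  { has-empty = Ramsey-∅ T ax em
  ; has-compl = Ramsey-∁ T
  ; has-union = Ramsey-⋃ T ax em closed
  }
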